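{- Let $n\ge1$ and let $G=(V,E)$ and $H=(V,F)$ be graphs on the common node set $V=\{1,\dots,n\}$ such that the edges of $H$ are pairwise node-disjoint. Let $t=\lvert F\rvert$, $k=n-t$, and let $V=V_1\cup\dots\cup V_k$ be the decomposition of $V$ into the node sets of the connected components of $H$ (each $V_i$ has one or two nodes). Assume that $E$ consists of exactly $\binom{k}{2}$ edges, namely for each $1\le i<j\le k$ exactly one edge $e_{ij}$, which joins a node of $V_i$ and a node of $V_j$. Let $I(G,H)$ denote the inequality, in variables $x_{uv}$ indexed by the edges of the complete graph on $V\cup\{n+1\}$, \[ \sum_{uv\in E} T(u,v;n+1)-\sum_{uv\in F}T(u,v;n+1)+2\sum_{i:\,V_i=\{u\}}x_{u,n+1}\le 2, \] where $T(u,v;w)=x_{uv}-x_{uw}-x_{vw}$ and the last sum runs over the components $V_i$ consisting of a single node $u$. Then $I(G,H)$ is valid for $\mathrm{CUT}^\square_{n+1}$. Moreover, for $S\subseteq V$, the cut vector $\boldsymbol{\delta}(S)$ satisfies $I(G,H)$ with equality if and only if one of the following holds: (i) there is a unique $i$ with $V_i\subseteq S$, and no edge of $G$ has both endpoints in $S$; (ii) there are exactly two indices $i_1,i_2$ with $V_{i}\subseteq S$, and $e_{i_1i_2}$ is the only edge of $G$ with both endpoints in $S$.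
   Context: For a graph with node set $W$ and edge set $D$, the cut vector $\boldsymbol{\delta}(S)\in\mathbb{R}^D$ of $S\subseteq W$ has $\delta_{uv}(S)=1$ if exactly one of $u,v$ lies in $S$, and $0$ otherwise. $\mathrm{CUT}^\square_N$ is the cut polytope of the complete graph $\mathrm{K}_N$: the convex hull of all cut vectors $\boldsymbol{\delta}(S)$, $S\subseteq\{1,\dots,N\}$, in $\mathbb{R}^{E(\mathrm{K}_N)}$. Here the $n+1$ nodes of $\mathrm{K}_{n+1}$ are $V\cup\{n+1\}$. An inequality is valid for a polytope if every point of the polytope satisfies it.
   Formalization: Validity of $I(G,H)$ for $\mathrm{CUT}^\square_{n+1}$ is asserted only at convex combinations of cut vectors with rational weights, whose coordinates are rational rather than real. -}

module Defs where

open import Data.Bool using (Bool; true; false; if_then_else_; _xor_; _∧_; not)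
open import Data.Nat using (ℕ; zero; suc)
open import Data.Fin using (Fin; zero; suc; _<_; inject₁; fromℕ)
open import Data.Fin.Properties using (<-cmp; _<?_)
open import Data.Product using (Σ; _×_; _,_)
open import Relation.Binary using (tri<; tri≈; tri>)
open import Relation.Binary.PropositionalEquality using (_≡_)
open import Relation.Nullary.Decidable using (⌊_⌋)
open import Data.Rational using (ℚ; 0ℚ; 1ℚ; _+_; _-_; _*_; _≤_)

record Graph (n : ℕ) : Set where
  field
    adj    : Fin n → Fin n → Bool
    sym    : ∀ u v → adj u v ≡ adj v u
    irrefl : ∀ u → adj u u ≡ false
open Graph public

Σℚ : (m : ℕ) → (Fin m → ℚ) → ℚ
Σℚ zero    f = 0ℚ
Σℚ (suc m) f = f zero + Σℚ m (λ i → f (suc i))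

anyFin : (m : ℕ) → (Fin m → Bool) → Bool
anyFin zero    f = false
anyFin (suc m) f = if f zero then true else anyFin m (λ i → f (suc i))

two : ℚ
two = 1ℚ + 1ℚ

Edge : ℕ → Set
Edge N = Σ (Fin N) λ u → Σ (Fin N) λ v → u < v

-- The coordinate x_{uv} of a vector in ℝ^{E(K_N)} (here ℚ^{E(K_N)}),
-- for an unordered pair {u,v}; (value 0 for u = v, never used).
coord : {N : ℕ} → (Edge N → ℚ) → Fin N → Fin N → ℚ
coord x u v with <-cmp u v
... | tri< p _ _ = x (u , v , p)
... | tri≈ _ _ _ = 0ℚ
... | tri> _ _ p = x (v , u , p)

δ : {N : ℕ} → (Fin N → Bool) → Edge N → ℚ
δ S (u , v , _) = if S u xor S v then 1ℚ else 0ℚ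

InCUT : (N : ℕ) → (Edge N → ℚ) → Set
InCUT N x =
  Σ ℕ λ m → Σ (Fin m → ℚ) λ lam → Σ (Fin m → (Fin N → Bool)) λ Ss →
    (∀ j → 0ℚ ≤ lam j) × (Σℚ m lam ≡ 1ℚ) ×
    (∀ e → x e ≡ Σℚ m (λ j → lam j * δ (Ss j) e))

ValidForCUT : (N : ℕ) → ((Edge N → ℚ) → ℚ) → ℚ → Set
ValidForCUT N f b = ∀ x → InCUT N x → f x ≤ b

-- Nodes of K_{n+1}: V = {1..n} embedded by inject₁, extra node n+1 = fromℕ n.
node : {n : ℕ} → Fin n → Fin (suc n)
node = inject₁

apex : (n : ℕ) → Fin (suc n)
apex n = fromℕ n

T : {N : ℕ} → (Edge N → ℚ) → Fin N → Fin N → Fin N → ℚ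
T x u v w = coord x u v - coord x u w - coord x v w

ΣEdges : {n : ℕ} → Graph n → (Fin n → Fin n → ℚ) → ℚ
ΣEdges {n} G f =
  Σℚ n λ u → Σℚ n λ v → if adj G u v ∧ ⌊ u <? v ⌋ then f u v else 0ℚ

-- u is an isolated node of H, i.e. {u} is a connected component of H.
isolated : {n : ℕ} → Graph n → Fin n → Bool
isolated {n} H u = not (anyFin n (adj H u))

lhsI : (n : ℕ) → Graph n → Graph n → (Edge (suc n) → ℚ) → ℚ
lhsI n G H x =
    ΣEdges G (λ u v → T x (node u) (node v) (apex n))
  - ΣEdges H (λ u v → T x (node u) (node v) (apex n))
  + two * Σℚ n (λ u → if isolated H u then coord x (node u) (apex n) else 0ℚ)

-- Extend S ⊆ V = Fin n to a subset of V ∪ {n+1} not containing n+1.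
extend : {n : ℕ} → (Fin n → Bool) → Fin (suc n) → Bool
extend {zero}  S zero    = false
extend {suc n} S zero    = S zero
extend {suc n} S (suc i) = extend (λ j → S (suc j)) i

{-# OPTIONS --safe #-}
module Submission where

-- Switch the cut δ(S) so that the apex n+1 lies outside S.  Then T(u,v;n+1) = -2[u,v ∈ S] and
-- x_{u,n+1} = [u ∈ S], so the left-hand side of I(G,H) at δ(S) is 2(e_H(S) + i_H(S) - e_G(S)), where
-- e_K(S) counts the edges of K inside S and i_H(S) the isolated nodes of H in S.  Since H is a matching,
-- e_H(S) + i_H(S) is the number m of components V_i ⊆ S.  G contains the edge e_ij inside S for every
-- pair of such components, so 2e_G(S) = m(m-1) + b, where b counts (in both orientations) the remaining
-- G-edges inside S.  The value is therefore 2 - (m-1)(m-2) - b ≤ 2, with equality iff m ∈ {1,2} and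
-- b = 0, which is (i) or (ii).  The left-hand side is linear, so the bound passes to convex combinations.

module Counting where

  open import Data.Bool as Bool using (Bool; true; false; _∧_; not)
  open import Data.Bool.Properties using (¬-not; not-¬; ∧-zeroʳ; ∧-identityʳ)
  open import Data.Empty using (⊥-elim)
  open import Data.Fin using (Fin; zero; suc)
  open import Data.Fin.Properties using (_≟_; ¬∀⟶∃¬)
  import Data.Fin.Properties as Fin
  open import Data.Nat using (ℕ; zero; suc; _+_; _*_)
  open import Data.Nat.Properties
    using ( +-*-semiring; *-commutativeSemigroup; +-identityʳ; *-zeroʳ; *-identityʳ
          ; 1+n≢0; suc-injective; m+n≡0⇒m≡0; m+n≡0⇒n≡0)
  open import Data.Product using (∃; ∃₂; _×_; _,_)
  import Data.Product
  open import Function using (_∘_; id)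
  open import Data.Sum using (_⊎_; inj₁; inj₂; [_,_])
  open import Function.Bundles using (_⇔_; mk⇔; Equivalence)
  open import Relation.Binary.PropositionalEquality hiding ([_])
  open import Relation.Nullary using (¬_; Dec; does; yes; no; contradiction)
  open import Relation.Nullary.Decidable using (dec-true; dec-false)
  open ≡-Reasoning
  open import Algebra.Properties.CommutativeSemigroup *-commutativeSemigroup using (x∙yz≈y∙xz)

  open import Algebra.Properties.Semiring.Sum +-*-semiring public
    using (sum; sum-syntax; sum-cong-≗; sum-replicate-zero; ∑-distrib-+; ∑-comm; *-distribˡ-sum; *-distribʳ-sum)

  𝟙 : Bool → ℕ
  𝟙 true  = 1
  𝟙 false = 0

  𝟙-∧ : ∀ x y → 𝟙 (x ∧ y) ≡ 𝟙 x * 𝟙 y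
  𝟙-∧ true  y = sym (+-identityʳ (𝟙 y))
  𝟙-∧ false y = refl

  𝟙*-true : ∀ {b} x → b ≡ true → 𝟙 b * x ≡ x
  𝟙*-true x refl = +-identityʳ x

  𝟙*-zero : ∀ b {x} → (b ≡ true → x ≡ 0) → 𝟙 b * x ≡ 0
  𝟙*-zero true  x≡0 = trans (+-identityʳ _) (x≡0 refl)
  𝟙*-zero false _   = refl

  𝟙≡0⇒ : ∀ {x} → 𝟙 x ≡ 0 → x ≡ false
  𝟙≡0⇒ {false} _ = refl

  𝟙-split : ∀ x y → 𝟙 x ≡ 𝟙 (x ∧ y) + 𝟙 (x ∧ not y)
  𝟙-split false y     = refl
  𝟙-split true  true  = refl
  𝟙-split true  false = refl

  *𝟙-split : ∀ x y → x ≡ x * 𝟙 y + x * 𝟙 (not y)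
  *𝟙-split x true  = sym (trans (cong (x * 1 +_) (*-zeroʳ x)) (trans (+-identityʳ (x * 1)) (*-identityʳ x)))
  *𝟙-split x false = sym (trans (cong (_+ x * 1) (*-zeroʳ x)) (*-identityʳ x))

  ∧≡true⇔ : ∀ {x y} → x ∧ y ≡ true ⇔ (x ≡ true × y ≡ true)
  ∧≡true⇔ {true}  = mk⇔ (λ y≡true → refl , y≡true) (λ (_ , y≡true) → y≡true)
  ∧≡true⇔ {false} = mk⇔ (λ ()) (λ ())

  true⇔true⇒≡ : ∀ {x y} → (x ≡ true ⇔ y ≡ true) → x ≡ y
  true⇔true⇒≡ {true}  x⇔y = sym (Equivalence.to x⇔y refl)
  true⇔true⇒≡ {false} {true}  x⇔y = Equivalence.from x⇔y refl
  true⇔true⇒≡ {false} {false} x⇔y = refl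

  does⇔ : ∀ {a} {A : Set a} (a? : Dec A) → does a? ≡ true ⇔ A
  does⇔ (yes a) = mk⇔ (λ _ → a) (λ _ → refl)
  does⇔ (no ¬a) = mk⇔ (λ ()) (λ a → ⊥-elim (¬a a))

  infix 4 _==_
  _==_ : ∀ {k} → Fin k → Fin k → Bool
  i == j = does (i ≟ j)

  ==⇒≡ : ∀ {k} {i j : Fin k} → (i == j) ≡ true → i ≡ j
  ==⇒≡ {i = i} {j} eq with i ≟ j
  ... | yes i≡j = i≡j

  ≡⇒== : ∀ {k} {i j : Fin k} → i ≡ j → (i == j) ≡ true
  ≡⇒== {i = i} {j} = dec-true (i ≟ j)

  ==-refl : ∀ {k} (i : Fin k) → (i == i) ≡ true
  ==-refl i = ≡⇒== {i = i} refl

  ≢⇒==-false : ∀ {k} {i j : Fin k} → i ≢ j → (i == j) ≡ false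
  ≢⇒==-false {i = i} {j} = dec-false (i ≟ j)

  sum-zero : ∀ {n} (f : Fin n → ℕ) → (∀ i → f i ≡ 0) → sum f ≡ 0
  sum-zero {n} f f≡0 = trans (sum-cong-≗ f≡0) (sum-replicate-zero n)

  sum≡0⇒ : ∀ {n} (f : Fin n → ℕ) → sum f ≡ 0 → ∀ i → f i ≡ 0
  sum≡0⇒ f eq zero    = m+n≡0⇒m≡0 (f zero) eq
  sum≡0⇒ f eq (suc i) = sum≡0⇒ (λ i → f (suc i)) (m+n≡0⇒n≡0 (f zero) eq) i

  sum-unique : ∀ {n} (f : Fin n → ℕ) a → (∀ i → i ≢ a → f i ≡ 0) → sum f ≡ f a
  sum-unique {suc n} f zero    others = begin
    f zero + sum (λ i → f (suc i)) ≡⟨ cong (f zero +_) (sum-zero _ (λ i → others (suc i) λ ())) ⟩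
    f zero + 0                     ≡⟨ +-identityʳ (f zero) ⟩
    f zero                         ∎
  sum-unique {suc n} f (suc a) others =
    cong₂ _+_ (others zero λ ())
              (sum-unique (λ i → f (suc i)) a (λ i i≢a → others (suc i) (i≢a ∘ Fin.suc-injective)))

  sum₂-unique : ∀ {n m} (F : Fin n → Fin m → ℕ) a b →
    (∀ u v → ¬ (u ≡ a × v ≡ b) → F u v ≡ 0) → ∑[ u < n ] ∑[ v < m ] F u v ≡ F a b
  sum₂-unique F a b others =
    trans (sum-unique _ a (λ u u≢a → sum-zero (F u) (λ v → others u v (λ (u≡a , _) → u≢a u≡a))))
          (sum-unique (F a) b (λ v v≢b → others a v (λ (_ , v≡b) → v≢b v≡b)))

  sum-pair : ∀ {n} (f : Fin n → ℕ) a b → a ≢ b → (∀ i → i ≢ a → i ≢ b → f i ≡ 0) →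
    sum f ≡ f a + f b
  sum-pair {n} f a b a≢b others = begin
    sum f
      ≡⟨ sum-cong-≗ (λ i → *𝟙-split (f i) (i == a)) ⟩
    ∑[ i < n ] (f i * 𝟙 (i == a) + f i * 𝟙 (not (i == a)))
      ≡⟨ ∑-distrib-+ (λ i → f i * 𝟙 (i == a)) _ ⟩
    ∑[ i < n ] (f i * 𝟙 (i == a)) + ∑[ i < n ] (f i * 𝟙 (not (i == a)))
      ≡⟨ cong₂ _+_ at-a at-b ⟩
    f a + f b ∎
    where
    at-a : ∑[ i < n ] (f i * 𝟙 (i == a)) ≡ f a
    at-a = trans (sum-unique _ a λ i i≢a → trans (cong (λ x → f i * 𝟙 x) (≢⇒==-false i≢a)) (*-zeroʳ (f i)))
                 (trans (cong (λ x → f a * 𝟙 x) (==-refl a)) (*-identityʳ (f a)))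
    outside-a : ∀ i → i ≢ b → f i * 𝟙 (not (i == a)) ≡ 0
    outside-a i i≢b with i ≟ a
    ... | yes _   = *-zeroʳ (f i)
    ... | no  i≢a = trans (*-identityʳ (f i)) (others i i≢a i≢b)
    at-b : ∑[ i < n ] (f i * 𝟙 (not (i == a))) ≡ f b
    at-b = trans (sum-unique _ b outside-a)
                 (trans (cong (λ x → f b * 𝟙 (not x)) (≢⇒==-false (a≢b ∘ sym))) (*-identityʳ (f b)))


  *-distribˡ-∑₂ : ∀ {n m} x (F : Fin n → Fin m → ℕ) →
    x * ∑[ u < n ] ∑[ v < m ] F u v ≡ ∑[ u < n ] ∑[ v < m ] (x * F u v)
  *-distribˡ-∑₂ {n} x F = trans (*-distribˡ-sum {n} x _) (sum-cong-≗ (λ u → *-distribˡ-sum x (F u)))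

  sum-fibres : ∀ {n k} (c : Fin n → Fin k) (F : Fin k → Fin n → ℕ) →
    ∑[ u < n ] F (c u) u ≡ ∑[ i < k ] ∑[ u < n ] (𝟙 (c u == i) * F i u)
  sum-fibres {n} {k} c F = trans (sum-cong-≗ (λ u → sym (fibre u))) (∑-comm (λ u i → 𝟙 (c u == i) * F i u))
    where
    fibre : ∀ u → ∑[ i < k ] (𝟙 (c u == i) * F i u) ≡ F (c u) u
    fibre u = trans (sum-unique _ (c u) λ i i≢cu → 𝟙*-zero (c u == i) (⊥-elim ∘ i≢cu ∘ sym ∘ ==⇒≡))
                    (𝟙*-true (F (c u) u) (==-refl (c u)))

  sum₂-fibres : ∀ {n k} (c : Fin n → Fin k) (a : Fin k → Fin k → ℕ) (e : Fin n → Fin n → ℕ) →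
    ∑[ u < n ] ∑[ v < n ] (a (c u) (c v) * e u v)
      ≡ ∑[ i < k ] ∑[ j < k ] (a i j * ∑[ u < n ] ∑[ v < n ] (𝟙 (c u == i) * (𝟙 (c v == j) * e u v)))
  sum₂-fibres {n} {k} c a e = begin
    ∑[ u < n ] ∑[ v < n ] (a (c u) (c v) * e u v)
      ≡⟨ sum-cong-≗ (λ u → sum-fibres c (λ j v → a (c u) j * e u v)) ⟩
    ∑[ u < n ] ∑[ j < k ] ∑[ v < n ] (𝟙 (c v == j) * (a (c u) j * e u v))
      ≡⟨ sum-fibres c (λ i u → ∑[ j < k ] ∑[ v < n ] (𝟙 (c v == j) * (a i j * e u v))) ⟩
    ∑[ i < k ] ∑[ u < n ] (𝟙 (c u == i) * ∑[ j < k ] ∑[ v < n ] (𝟙 (c v == j) * (a i j * e u v)))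
      ≡⟨ sum-cong-≗ (λ i → trans (sum-cong-≗ λ u → *-distribˡ-∑₂ {k} {n} (𝟙 (c u == i)) _)
                                 (∑-comm {n} {k} _)) ⟩
    ∑[ i < k ] ∑[ j < k ] ∑[ u < n ] ∑[ v < n ] (𝟙 (c u == i) * (𝟙 (c v == j) * (a i j * e u v)))
      ≡⟨ sum-cong-≗ (λ i → sum-cong-≗ λ j →
           trans (sum-cong-≗ λ u → sum-cong-≗ λ v → swap-factors (𝟙 (c u == i)) (𝟙 (c v == j)) (a i j) (e u v))
                 (sym (*-distribˡ-∑₂ {n} {n} (a i j) _))) ⟩
    ∑[ i < k ] ∑[ j < k ] (a i j * ∑[ u < n ] ∑[ v < n ] (𝟙 (c u == i) * (𝟙 (c v == j) * e u v))) ∎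
    where
    swap-factors : ∀ x y z w → x * (y * (z * w)) ≡ z * (x * (y * w))
    swap-factors x y z w = trans (cong (x *_) (x∙yz≈y∙xz y z w)) (x∙yz≈y∙xz x z (y * w))

  count : ∀ {n} → (Fin n → Bool) → ℕ
  count {n} b = ∑[ i < n ] 𝟙 (b i)

  count≡0⇔ : ∀ {n} (b : Fin n → Bool) → count b ≡ 0 ⇔ (∀ i → b i ≡ false)
  count≡0⇔ b = mk⇔ (λ eq i → 𝟙≡0⇒ (sum≡0⇒ _ eq i))
                   (λ b≡false → sum-zero _ (λ i → cong 𝟙 (b≡false i)))

  count≢0⇒ : ∀ {n} (b : Fin n → Bool) → count b ≢ 0 → ∃ λ i → b i ≡ true
  count≢0⇒ {n} b count≢0 =
    Data.Product.map₂ ¬-not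
      (¬∀⟶∃¬ n (λ i → b i ≡ false) (λ i → b i Bool.≟ false) (count≢0 ∘ Equivalence.from (count≡0⇔ b)))

  without : ∀ {n} → (Fin n → Bool) → Fin n → Fin n → Bool
  without b a i = b i ∧ not (i == a)

  without≡true⇔ : ∀ {n} (b : Fin n → Bool) a i → without b a i ≡ true ⇔ (b i ≡ true × i ≢ a)
  without≡true⇔ b a i = mk⇔ to from
    where
    to : without b a i ≡ true → b i ≡ true × i ≢ a
    to eq with Equivalence.to ∧≡true⇔ eq
    ... | bi , i≠a = bi , λ i≡a → not-¬ i≠a (cong not (≡⇒== {i = i} i≡a))
    from : b i ≡ true × i ≢ a → without b a i ≡ true
    from (bi , i≢a) = Equivalence.from ∧≡true⇔ (bi , cong not (≢⇒==-false i≢a))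

  count-without : ∀ {n} (b : Fin n → Bool) a → count b ≡ 𝟙 (b a) + count (without b a)
  count-without {n} b a = begin
    count b                                              ≡⟨ sum-cong-≗ (λ i → 𝟙-split (b i) (i == a)) ⟩
    ∑[ i < n ] (𝟙 (b i ∧ (i == a)) + 𝟙 (without b a i)) ≡⟨ ∑-distrib-+ (λ i → 𝟙 (b i ∧ (i == a))) _ ⟩
    ∑[ i < n ] 𝟙 (b i ∧ (i == a)) + count (without b a)  ≡⟨ cong (_+ count (without b a)) at-a ⟩
    𝟙 (b a) + count (without b a)                        ∎
    where
    at-a : ∑[ i < n ] 𝟙 (b i ∧ (i == a)) ≡ 𝟙 (b a)
    at-a = trans (sum-unique _ a λ i i≢a → cong 𝟙 (trans (cong (b i ∧_) (≢⇒==-false i≢a)) (∧-zeroʳ (b i))))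
                 (cong 𝟙 (trans (cong (b a ∧_) (==-refl a)) (∧-identityʳ (b a))))

  count-without-member : ∀ {n} (b : Fin n → Bool) {a} → b a ≡ true → count b ≡ suc (count (without b a))
  count-without-member b {a} ba = trans (count-without b a) (cong (λ x → 𝟙 x + count (without b a)) ba)

  count≡1⇔ : ∀ {n} (b : Fin n → Bool) →
    count b ≡ 1 ⇔ ∃ λ a → b a ≡ true × (∀ i → b i ≡ true → i ≡ a)
  count≡1⇔ b = mk⇔ to from
    where
    to : count b ≡ 1 → ∃ λ a → b a ≡ true × (∀ i → b i ≡ true → i ≡ a)
    to count≡1 with count≢0⇒ b (λ count≡0 → 1+n≢0 (trans (sym count≡1) count≡0))
    ... | a , ba = a , ba , unique
      where
      rest≡0 : count (without b a) ≡ 0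
      rest≡0 = sym (suc-injective (trans (sym count≡1) (count-without-member b ba)))
      unique : ∀ i → b i ≡ true → i ≡ a
      unique i bi with i ≟ a
      ... | yes i≡a = i≡a
      ... | no  i≢a = contradiction (Equivalence.from (without≡true⇔ b a i) (bi , i≢a))
                                    (not-¬ (Equivalence.to (count≡0⇔ _) rest≡0 i))
    from : (∃ λ a → b a ≡ true × (∀ i → b i ≡ true → i ≡ a)) → count b ≡ 1
    from (a , ba , unique) = trans (sum-unique _ a λ i i≢a → cong 𝟙 (¬-not (i≢a ∘ unique i))) (cong 𝟙 ba)

  count≡2⇔ : ∀ {n} (b : Fin n → Bool) →
    count b ≡ 2 ⇔ ∃₂ λ a₁ a₂ → a₁ ≢ a₂ × (∀ i → b i ≡ true ⇔ (i ≡ a₁ ⊎ i ≡ a₂))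
  count≡2⇔ b = mk⇔ to from
    where
    to : count b ≡ 2 → ∃₂ λ a₁ a₂ → a₁ ≢ a₂ × (∀ i → b i ≡ true ⇔ (i ≡ a₁ ⊎ i ≡ a₂))
    to count≡2 with count≢0⇒ b (λ count≡0 → 1+n≢0 (trans (sym count≡2) count≡0))
    ... | a₁ , ba₁ with Equivalence.to (count≡1⇔ (without b a₁))
                          (sym (suc-injective (trans (sym count≡2) (count-without-member b ba₁))))
    ... | a₂ , wa₂ , unique with Equivalence.to (without≡true⇔ b a₁ a₂) wa₂
    ... | ba₂ , a₂≢a₁ = a₁ , a₂ , a₂≢a₁ ∘ sym , λ i → mk⇔ (members i) present
      where
      present : ∀ {i} → i ≡ a₁ ⊎ i ≡ a₂ → b i ≡ true
      present (inj₁ refl) = ba₁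
      present (inj₂ refl) = ba₂
      members : ∀ i → b i ≡ true → i ≡ a₁ ⊎ i ≡ a₂
      members i bi with i ≟ a₁
      ... | yes i≡a₁ = inj₁ i≡a₁
      ... | no  i≢a₁ = inj₂ (unique i (Equivalence.from (without≡true⇔ b a₁ i) (bi , i≢a₁)))
    from : (∃₂ λ a₁ a₂ → a₁ ≢ a₂ × (∀ i → b i ≡ true ⇔ (i ≡ a₁ ⊎ i ≡ a₂))) → count b ≡ 2
    from (a₁ , a₂ , a₁≢a₂ , members) =
      trans (count-without-member b (Equivalence.from (members a₁) (inj₁ refl))) (cong suc rest≡1)
      where
      rest≡1 : count (without b a₁) ≡ 1
      rest≡1 = Equivalence.from (count≡1⇔ (without b a₁))
        ( a₂
        , Equivalence.from (without≡true⇔ b a₁ a₂) (Equivalence.from (members a₂) (inj₂ refl) , a₁≢a₂ ∘ sym)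
        , λ i wi → let (bi , i≢a₁) = Equivalence.to (without≡true⇔ b a₁ i) wi in
                   [ (λ i≡a₁ → contradiction i≡a₁ i≢a₁) , id ] (Equivalence.to (members i) bi))

  count-pairs : ∀ {k} (b : Fin k → Bool) →
    count b * count b ≡ count b + ∑[ i < k ] ∑[ j < k ] (𝟙 (b i) * 𝟙 (b j) * 𝟙 (not (i == j)))
  count-pairs {k} b = begin
    count b * count b
      ≡⟨ *-distribʳ-sum {k} (count b) (𝟙 ∘ b) ⟩
    ∑[ i < k ] (𝟙 (b i) * count b)
      ≡⟨ sum-cong-≗ (λ i → *-distribˡ-sum {k} (𝟙 (b i)) (𝟙 ∘ b)) ⟩
    ∑[ i < k ] ∑[ j < k ] (𝟙 (b i) * 𝟙 (b j))
      ≡⟨ sum-cong-≗ split ⟩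
    ∑[ i < k ] (∑[ j < k ] on i j + ∑[ j < k ] off i j)
      ≡⟨ sum-cong-≗ (λ i → cong (_+ ∑[ j < k ] off i j) (diagonal i)) ⟩
    ∑[ i < k ] (𝟙 (b i) + ∑[ j < k ] off i j)
      ≡⟨ ∑-distrib-+ (𝟙 ∘ b) (λ i → ∑[ j < k ] off i j) ⟩
    count b + ∑[ i < k ] ∑[ j < k ] off i j ∎
    where
    on off : Fin k → Fin k → ℕ
    on  i j = 𝟙 (b i) * 𝟙 (b j) * 𝟙 (i == j)
    off i j = 𝟙 (b i) * 𝟙 (b j) * 𝟙 (not (i == j))
    split : ∀ i → ∑[ j < k ] (𝟙 (b i) * 𝟙 (b j)) ≡ ∑[ j < k ] on i j + ∑[ j < k ] off i j
    split i = trans (sum-cong-≗ λ j → *𝟙-split _ (i == j)) (∑-distrib-+ (on i) (off i))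
    𝟙-idem : ∀ x → 𝟙 x * 𝟙 x ≡ 𝟙 x
    𝟙-idem true  = refl
    𝟙-idem false = refl
    off-diagonal : ∀ i j → j ≢ i → on i j ≡ 0
    off-diagonal i j j≢i =
      trans (cong (λ x → 𝟙 (b i) * 𝟙 (b j) * 𝟙 x) (≢⇒==-false (j≢i ∘ sym))) (*-zeroʳ (𝟙 (b i) * 𝟙 (b j)))
    diagonal : ∀ i → ∑[ j < k ] on i j ≡ 𝟙 (b i)
    diagonal i = begin
      ∑[ j < k ] on i j            ≡⟨ sum-unique (on i) i (off-diagonal i) ⟩
      𝟙 (b i) * 𝟙 (b i) * 𝟙 (i == i) ≡⟨ cong (λ x → 𝟙 (b i) * 𝟙 (b i) * 𝟙 x) (==-refl i) ⟩
      𝟙 (b i) * 𝟙 (b i) * 1        ≡⟨ *-identityʳ (𝟙 (b i) * 𝟙 (b i)) ⟩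
      𝟙 (b i) * 𝟙 (b i)            ≡⟨ 𝟙-idem (b i) ⟩
      𝟙 (b i)                      ∎

module Quadratic where

  open import Data.Nat using (ℕ; suc; _+_; _*_; _≤_)
  open import Data.Nat.Properties
    using (+-identityʳ; +-cancelʳ-≡; +-cancelˡ-≡; *-cancelˡ-≡; *-cancelˡ-≤; m≤m+n; m+n≡0⇒m≡0; m+n≡0⇒n≡0)
  open import Data.Nat.Solver using (module +-*-Solver)
  open import Data.Product using (_×_; _,_)
  open import Data.Sum using (_⊎_; inj₁; inj₂)
  open import Function.Bundles using (_⇔_; mk⇔; Equivalence)
  open import Relation.Binary.PropositionalEquality
  open +-*-Solver using (solve; _:=_; _:+_; _:*_; con)
  open ≡-Reasoning

  -- (m - 1) * (m - 2), written without truncated subtraction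
  gap : ℕ → ℕ
  gap 0                   = 2
  gap 1                   = 0
  gap (suc (suc t))       = t * suc t

  m*m+2≡3*m+gap : ∀ m → m * m + 2 ≡ 3 * m + gap m
  m*m+2≡3*m+gap 0             = refl
  m*m+2≡3*m+gap 1             = refl
  m*m+2≡3*m+gap (suc (suc t)) =
    solve 1 (λ t → (con 2 :+ t) :* (con 2 :+ t) :+ con 2 := con 3 :* (con 2 :+ t) :+ t :* (con 1 :+ t)) refl t

  gap≡0⇔ : ∀ m → gap m ≡ 0 ⇔ (m ≡ 1 ⊎ m ≡ 2)
  gap≡0⇔ 0                   = mk⇔ (λ ()) λ { (inj₁ ()) ; (inj₂ ()) }
  gap≡0⇔ 1                   = mk⇔ (λ _ → inj₁ refl) (λ _ → refl)
  gap≡0⇔ 2                   = mk⇔ (λ _ → inj₂ refl) (λ _ → refl)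
  gap≡0⇔ (suc (suc (suc t))) = mk⇔ (λ ()) λ { (inj₁ ()) ; (inj₂ ()) }

  module _ (m e B : ℕ) (hyp : 2 * e + m ≡ m * m + B) where

    2*[e+1]≡2*m+slack : 2 * (e + 1) ≡ 2 * m + (gap m + B)
    2*[e+1]≡2*m+slack = +-cancelʳ-≡ m _ _ (begin
      2 * (e + 1) + m           ≡⟨ solve 2 (λ e m → con 2 :* (e :+ con 1) :+ m := (con 2 :* e :+ m) :+ con 2) refl e m ⟩
      (2 * e + m) + 2           ≡⟨ cong (_+ 2) hyp ⟩
      (m * m + B) + 2           ≡⟨ solve 2 (λ x B → (x :+ B) :+ con 2 := (x :+ con 2) :+ B) refl (m * m) B ⟩
      (m * m + 2) + B           ≡⟨ cong (_+ B) (m*m+2≡3*m+gap m) ⟩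
      (3 * m + gap m) + B       ≡⟨ solve 3 (λ m g B → (con 3 :* m :+ g) :+ B := con 2 :* m :+ (g :+ B) :+ m)
                                           refl m (gap m) B ⟩
      2 * m + (gap m + B) + m   ∎)

    quadratic-bound : m ≤ e + 1
    quadratic-bound = *-cancelˡ-≤ 2 (subst (2 * m ≤_) (sym 2*[e+1]≡2*m+slack) (m≤m+n (2 * m) _))

    quadratic-tight : m ≡ e + 1 ⇔ ((m ≡ 1 ⊎ m ≡ 2) × B ≡ 0)
    quadratic-tight = mk⇔ to from
      where
      to : m ≡ e + 1 → (m ≡ 1 ⊎ m ≡ 2) × B ≡ 0
      to m≡e+1 = Equivalence.to (gap≡0⇔ m) (m+n≡0⇒m≡0 (gap m) slack≡0) , m+n≡0⇒n≡0 (gap m) slack≡0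
        where
        slack≡0 : gap m + B ≡ 0
        slack≡0 = +-cancelˡ-≡ (2 * m) _ _
          (trans (sym 2*[e+1]≡2*m+slack) (trans (cong (2 *_) (sym m≡e+1)) (sym (+-identityʳ (2 * m)))))
      from : (m ≡ 1 ⊎ m ≡ 2) × B ≡ 0 → m ≡ e + 1
      from (m∈12 , B≡0) = sym (*-cancelˡ-≡ _ _ 2 (trans 2*[e+1]≡2*m+slack
        (trans (cong₂ (λ g b → 2 * m + (g + b)) (Equivalence.from (gap≡0⇔ m) m∈12) B≡0) (+-identityʳ (2 * m)))))

module EdgeCounts where

  open import Defs using (Graph; adj; isolated; anyFin)
  open Counting
  open Quadratic using (quadratic-bound; quadratic-tight)
  open import Data.Bool as Bool using (Bool; true; false; _∧_; not)
  open import Data.Bool.Properties using (∧-comm; ¬-not; not-injective; ∧-identityʳ)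
  open import Data.Empty using (⊥; ⊥-elim)
  open import Data.Fin using (Fin; zero; suc; _<_)
  open import Data.Fin.Properties using (_≟_; _<?_; <-cmp; all?)
  open import Data.Nat using (ℕ; zero; suc; _+_; _*_; _≤_)
  open import Data.Nat.Properties using (+-identityʳ; *-distribˡ-+; *-cancelˡ-≡)
  open import Data.Product using (Σ; ∃; _×_; _,_; proj₁; proj₂; swap)
  open import Data.Sum using (_⊎_; inj₁; inj₂; [_,_])
  open import Function using (_∘_; case_of_)
  open import Function.Bundles using (_⇔_; mk⇔; Equivalence)
  import Data.Product
  open import Relation.Binary using (tri<; tri≈; tri>)
  open import Relation.Unary using (Decidable)
  open import Relation.Binary.PropositionalEquality hiding ([_])
  open import Relation.Nullary using (does; contradiction)
  open import Relation.Nullary.Decidable using (⌊_⌋; _→-dec_; dec-true; dec-false; isYes≗does)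
  open ≡-Reasoning
  open import Data.Nat.Solver using (module +-*-Solver)
  open +-*-Solver using (solve; _:=_; _:+_)

  module _ {n} (K : Graph n) (s : Fin n → Bool) where

    arcsWithin : ℕ
    arcsWithin = ∑[ u < n ] count (λ v → adj K u v ∧ (s u ∧ s v))

    edgesWithin : ℕ
    edgesWithin = ∑[ u < n ] count (λ v → (adj K u v ∧ ⌊ u <? v ⌋) ∧ (s u ∧ s v))

    isolatedWithin : ℕ
    isolatedWithin = count (λ u → isolated K u ∧ s u)

    arcsWithin≡2*edgesWithin : arcsWithin ≡ 2 * edgesWithin
    arcsWithin≡2*edgesWithin = begin
      arcsWithin
        ≡⟨ sum-cong-≗ (λ u → trans (sum-cong-≗ (one-orientation u)) (∑-distrib-+ (forward u) _)) ⟩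
      ∑[ u < n ] (∑[ v < n ] forward u v + ∑[ v < n ] forward v u)
        ≡⟨ ∑-distrib-+ (λ u → ∑[ v < n ] forward u v) _ ⟩
      edgesWithin + ∑[ u < n ] ∑[ v < n ] forward v u
        ≡⟨ cong (edgesWithin +_) (∑-comm (λ u v → forward v u)) ⟩
      edgesWithin + edgesWithin
        ≡⟨ cong (edgesWithin +_) (sym (+-identityʳ edgesWithin)) ⟩
      2 * edgesWithin ∎
      where
      forward : Fin n → Fin n → ℕ
      forward u v = 𝟙 ((adj K u v ∧ ⌊ u <? v ⌋) ∧ (s u ∧ s v))
      exactly-one-direction : ∀ u v → adj K u v ≡ true → ⌊ u <? v ⌋ ≡ not ⌊ v <? u ⌋
      exactly-one-direction u v uv with <-cmp u v
      ... | tri< u<v _ v≮u = trans (trans (isYes≗does (u <? v)) (dec-true (u <? v) u<v))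
                                   (cong not (sym (trans (isYes≗does (v <? u)) (dec-false (v <? u) v≮u))))
      ... | tri> u≮v _ v<u = trans (trans (isYes≗does (u <? v)) (dec-false (u <? v) u≮v))
                                   (cong not (sym (trans (isYes≗does (v <? u)) (dec-true (v <? u) v<u))))
      ... | tri≈ _ refl _ = contradiction (trans (sym uv) (Graph.irrefl K u)) λ ()
      split-by-direction : ∀ a l l′ w → (a ≡ true → l ≡ not l′) →
        𝟙 (a ∧ w) ≡ 𝟙 ((a ∧ l) ∧ w) + 𝟙 ((a ∧ l′) ∧ w)
      split-by-direction false l l′ w _ = refl
      split-by-direction true l l′ w l≡¬l′ rewrite l≡¬l′ refl with l′ | w
      ... | true  | true  = refl
      ... | true  | false = refl
      ... | false | true  = refl
      ... | false | false = refl
      one-orientation : ∀ u v → 𝟙 (adj K u v ∧ (s u ∧ s v)) ≡ forward u v + forward v u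
      one-orientation u v =
        trans (split-by-direction (adj K u v) ⌊ u <? v ⌋ ⌊ v <? u ⌋ (s u ∧ s v) (exactly-one-direction u v))
              (cong₂ (λ a w → 𝟙 ((adj K u v ∧ ⌊ u <? v ⌋) ∧ (s u ∧ s v)) + 𝟙 ((a ∧ ⌊ v <? u ⌋) ∧ w))
                     (Graph.sym K u v) (∧-comm (s u) (s v)))

  anyFin≡false⇒ : ∀ {m} (f : Fin m → Bool) → anyFin m f ≡ false → ∀ i → f i ≡ false
  anyFin≡false⇒ {suc m} f eq i with f zero in f0
  anyFin≡false⇒ {suc m} f eq zero    | false = f0
  anyFin≡false⇒ {suc m} f eq (suc i) | false = anyFin≡false⇒ (f ∘ suc) eq i

  anyFin≡true⇒ : ∀ {m} (f : Fin m → Bool) → anyFin m f ≡ true → ∃ λ i → f i ≡ true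
  anyFin≡true⇒ {suc m} f eq with f zero in f0
  ... | true  = zero , f0
  ... | false = Data.Product.map suc (λ fi → fi) (anyFin≡true⇒ (f ∘ suc) eq)

  module _ {n} (K : Graph n) where

    isolated⇒¬adj : ∀ {u} v → isolated K u ≡ true → adj K u v ≡ false
    isolated⇒¬adj {u} v iso = anyFin≡false⇒ (adj K u) (not-injective iso) v

    ¬isolated⇒adj : ∀ {u} → isolated K u ≡ false → ∃ λ v → adj K u v ≡ true
    ¬isolated⇒adj {u} iso = anyFin≡true⇒ (adj K u) (not-injective iso)

    adj⇒¬isolated : ∀ {u v} → adj K u v ≡ true → isolated K u ≡ false
    adj⇒¬isolated {u} {v} uv with isolated K u in iso
    ... | true  = contradiction (trans (sym uv) (isolated⇒¬adj v iso)) λ ()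
    ... | false = refl

  module Components {n k} (c : Fin n → Fin k) (s : Fin n → Bool) where

    Full : Fin k → Set
    Full i = ∀ u → c u ≡ i → s u ≡ true

    Full? : Decidable Full
    Full? i = all? (λ u → (c u ≟ i) →-dec (s u Bool.≟ true))

    full : Fin k → Bool
    full i = does (Full? i)

    full⇔ : ∀ i → full i ≡ true ⇔ Full i
    full⇔ i = does⇔ (Full? i)

    fullCount : ℕ
    fullCount = count full

    ConditionI : Graph n → Set
    ConditionI G = Σ (Fin k) λ i →
      Full i × (∀ i′ → Full i′ → i′ ≡ i) ×
      (∀ u v → adj G u v ≡ true → s u ≡ true → s v ≡ true → ⊥)

    ConditionII : Graph n → Set
    ConditionII G = Σ (Fin k) λ i₁ → Σ (Fin k) λ i₂ →
      i₁ ≢ i₂ × (∀ i → Full i ⇔ ((i ≡ i₁) ⊎ (i ≡ i₂))) ×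
      (∀ u v → adj G u v ≡ true → s u ≡ true → s v ≡ true →
         ((c u ≡ i₁) × (c v ≡ i₂)) ⊎ ((c u ≡ i₂) × (c v ≡ i₁)))

    outside-fibre : ∀ i u {x} → c u ≢ i → 𝟙 (c u == i) * x ≡ 0
    outside-fibre i u cu≢i = 𝟙*-zero (c u == i) (⊥-elim ∘ cu≢i ∘ ==⇒≡)

    inside-fibre : ∀ i u {x} → c u ≡ i → 𝟙 (c u == i) * x ≡ x
    inside-fibre i u {x} cu≡i = 𝟙*-true x (≡⇒== cu≡i)

    module Matching (H : Graph n)
      (disjoint : ∀ u v w → adj H u v ≡ true → adj H u w ≡ true → v ≡ w)
      (components : ∀ u v → (c u ≡ c v) ⇔ ((u ≡ v) ⊎ (adj H u v ≡ true)))
      where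

      -- twice u's share of the H-edges and isolated nodes inside s, so that an edge is split evenly
      weight : Fin n → ℕ
      weight u = count (λ v → adj H u v ∧ (s u ∧ s v)) + 2 * 𝟙 (isolated H u ∧ s u)

      neighbour-count : ∀ {u v} (t : Fin n → Bool) → adj H u v ≡ true →
        count (λ w → adj H u w ∧ t w) ≡ 𝟙 (t v)
      neighbour-count {u} {v} t uv =
        trans (sum-unique _ v λ w w≢v → cong (λ a → 𝟙 (a ∧ t w)) (¬-not (w≢v ∘ sym ∘ disjoint u v w uv)))
              (cong (λ a → 𝟙 (a ∧ t v)) uv)

      fibre-members : ∀ {u₀} u → c u ≡ c u₀ → u ≡ u₀ ⊎ adj H u₀ u ≡ true
      fibre-members {u₀} u cu≡cu₀ with Equivalence.to (components u u₀) cu≡cu₀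
      ... | inj₁ u≡u₀ = inj₁ u≡u₀
      ... | inj₂ uu₀  = inj₂ (trans (Graph.sym H u₀ u) uu₀)

      singleton-fibre : ∀ {i u₀} → c u₀ ≡ i → isolated H u₀ ≡ true →
        ∑[ u < n ] (𝟙 (c u == i) * weight u) ≡ 2 * 𝟙 (full i)
      singleton-fibre {i} {u₀} cu₀ iso = begin
        ∑[ u < n ] (𝟙 (c u == i) * weight u) ≡⟨ sum-unique _ u₀ (λ u u≢u₀ → outside-fibre i u (u≢u₀ ∘ only-u₀ u)) ⟩
        𝟙 (c u₀ == i) * weight u₀            ≡⟨ inside-fibre i u₀ cu₀ ⟩
        weight u₀                            ≡⟨ cong₂ (λ x y → x + 2 * 𝟙 (y ∧ s u₀)) no-neighbours iso ⟩
        2 * 𝟙 (s u₀)                         ≡⟨ cong (λ x → 2 * 𝟙 x) (true⇔true⇒≡ full⇔s) ⟨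
        2 * 𝟙 (full i)                       ∎
        where
        only-u₀ : ∀ u → c u ≡ i → u ≡ u₀
        only-u₀ u cu with fibre-members u (trans cu (sym cu₀))
        ... | inj₁ u≡u₀ = u≡u₀
        ... | inj₂ u₀u  = contradiction (trans (sym u₀u) (isolated⇒¬adj H u iso)) λ ()
        no-neighbours : count (λ v → adj H u₀ v ∧ (s u₀ ∧ s v)) ≡ 0
        no-neighbours = Equivalence.from (count≡0⇔ _) (λ v → cong (_∧ (s u₀ ∧ s v)) (isolated⇒¬adj H v iso))
        full⇔s : full i ≡ true ⇔ s u₀ ≡ true
        full⇔s = mk⇔ (λ fi → Equivalence.to (full⇔ i) fi u₀ cu₀)
                     (λ su₀ → Equivalence.from (full⇔ i) λ u cu → subst (λ w → s w ≡ true) (sym (only-u₀ u cu)) su₀)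

      pair-fibre : ∀ {i u₀ v₀} → c u₀ ≡ i → adj H u₀ v₀ ≡ true →
        ∑[ u < n ] (𝟙 (c u == i) * weight u) ≡ 2 * 𝟙 (full i)
      pair-fibre {i} {u₀} {v₀} cu₀ u₀v₀ = begin
        ∑[ u < n ] (𝟙 (c u == i) * weight u)
          ≡⟨ sum-pair _ u₀ v₀ u₀≢v₀ (λ u u≢u₀ u≢v₀ → outside-fibre i u ([ u≢u₀ , u≢v₀ ] ∘ only-u₀v₀ u)) ⟩
        𝟙 (c u₀ == i) * weight u₀ + 𝟙 (c v₀ == i) * weight v₀
          ≡⟨ cong₂ _+_ (inside-fibre i u₀ cu₀) (inside-fibre i v₀ cv₀) ⟩
        weight u₀ + weight v₀
          ≡⟨ cong₂ _+_ (partner-weight u₀v₀) (partner-weight v₀u₀) ⟩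
        𝟙 (s u₀ ∧ s v₀) + 𝟙 (s v₀ ∧ s u₀)
          ≡⟨ cong (𝟙 (s u₀ ∧ s v₀) +_) (trans (cong 𝟙 (∧-comm (s v₀) (s u₀))) (sym (+-identityʳ _))) ⟩
        2 * 𝟙 (s u₀ ∧ s v₀)
          ≡⟨ cong (λ x → 2 * 𝟙 x) (true⇔true⇒≡ full⇔s) ⟨
        2 * 𝟙 (full i) ∎
        where
        v₀u₀ : adj H v₀ u₀ ≡ true
        v₀u₀ = trans (Graph.sym H v₀ u₀) u₀v₀
        u₀≢v₀ : u₀ ≢ v₀
        u₀≢v₀ refl = contradiction (trans (sym u₀v₀) (Graph.irrefl H u₀)) λ ()
        cv₀ : c v₀ ≡ i
        cv₀ = trans (Equivalence.from (components v₀ u₀) (inj₂ v₀u₀)) cu₀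
        only-u₀v₀ : ∀ u → c u ≡ i → u ≡ u₀ ⊎ u ≡ v₀
        only-u₀v₀ u cu with fibre-members u (trans cu (sym cu₀))
        ... | inj₁ u≡u₀ = inj₁ u≡u₀
        ... | inj₂ u₀u  = inj₂ (sym (disjoint u₀ v₀ u u₀v₀ u₀u))
        partner-weight : ∀ {u v} → adj H u v ≡ true → weight u ≡ 𝟙 (s u ∧ s v)
        partner-weight {u} {v} uv =
          trans (cong₂ (λ x y → x + 2 * 𝟙 (y ∧ s u)) (neighbour-count (λ w → s u ∧ s w) uv) (adj⇒¬isolated H uv))
                (+-identityʳ _)
        full⇔s : full i ≡ true ⇔ (s u₀ ∧ s v₀) ≡ true
        full⇔s = mk⇔ (λ fi → Equivalence.from ∧≡true⇔ (Full-i fi u₀ cu₀ , Full-i fi v₀ cv₀))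
                     (λ both → Equivalence.from (full⇔ i) λ u → ends-in-s (Equivalence.to ∧≡true⇔ both) ∘ only-u₀v₀ u)
          where
          Full-i : full i ≡ true → Full i
          Full-i = Equivalence.to (full⇔ i)
          ends-in-s : ∀ {u} → s u₀ ≡ true × s v₀ ≡ true → u ≡ u₀ ⊎ u ≡ v₀ → s u ≡ true
          ends-in-s (su₀ , _) (inj₁ refl) = su₀
          ends-in-s (_ , sv₀) (inj₂ refl) = sv₀

      fibre-weight : ∀ i → (∃ λ u → c u ≡ i) → ∑[ u < n ] (𝟙 (c u == i) * weight u) ≡ 2 * 𝟙 (full i)
      fibre-weight i (u₀ , cu₀) with isolated H u₀ in iso
      ... | true  = singleton-fibre cu₀ iso
      ... | false = pair-fibre cu₀ (proj₂ (¬isolated⇒adj H iso))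

      matched+isolated≡fullCount : (∀ i → ∃ λ u → c u ≡ i) → edgesWithin H s + isolatedWithin H s ≡ fullCount
      matched+isolated≡fullCount nonempty = *-cancelˡ-≡ _ _ 2 (begin
        2 * (edgesWithin H s + isolatedWithin H s)
          ≡⟨ *-distribˡ-+ 2 (edgesWithin H s) _ ⟩
        2 * edgesWithin H s + 2 * isolatedWithin H s
          ≡⟨ cong₂ _+_ (sym (arcsWithin≡2*edgesWithin H s)) (*-distribˡ-sum {n} 2 _) ⟩
        arcsWithin H s + ∑[ u < n ] (2 * 𝟙 (isolated H u ∧ s u))
          ≡⟨ ∑-distrib-+ (λ u → count (λ v → adj H u v ∧ (s u ∧ s v))) _ ⟨
        ∑[ u < n ] weight u
          ≡⟨ sum-fibres c (λ _ u → weight u) ⟩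
        ∑[ i < k ] ∑[ u < n ] (𝟙 (c u == i) * weight u)
          ≡⟨ sum-cong-≗ (λ i → fibre-weight i (nonempty i)) ⟩
        ∑[ i < k ] (2 * 𝟙 (full i))
          ≡⟨ *-distribˡ-sum {k} 2 (𝟙 ∘ full) ⟨
        2 * fullCount ∎)

    module OneEdgeBetween (G : Graph n)
      (cross : ∀ u v → adj G u v ≡ true → c u ≢ c v)
      (unique-edge : ∀ i j → i < j →
        Σ (Fin n) λ a → Σ (Fin n) λ b →
          c a ≡ i × c b ≡ j × adj G a b ≡ true ×
          (∀ a′ b′ → c a′ ≡ i → c b′ ≡ j → adj G a′ b′ ≡ true → (a′ ≡ a) × (b′ ≡ b)))
      where

      arcsBetween : Fin k → Fin k → ℕ
      arcsBetween i j = ∑[ u < n ] ∑[ v < n ] (𝟙 (c u == i) * (𝟙 (c v == j) * 𝟙 (adj G u v)))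

      arc-term-zero : ∀ {i j} u v → (c u ≡ i → c v ≡ j → adj G u v ≡ true → ⊥) →
        𝟙 (c u == i) * (𝟙 (c v == j) * 𝟙 (adj G u v)) ≡ 0
      arc-term-zero u v no-arc = 𝟙*-zero _ λ cu → 𝟙*-zero _ λ cv →
        cong 𝟙 (¬-not (no-arc (==⇒≡ cu) (==⇒≡ cv)))

      arc-term-one : ∀ {i j} u v → c u ≡ i → c v ≡ j → adj G u v ≡ true →
        𝟙 (c u == i) * (𝟙 (c v == j) * 𝟙 (adj G u v)) ≡ 1
      arc-term-one u v cu cv uv = trans (inside-fibre _ u cu) (trans (inside-fibre _ v cv) (cong 𝟙 uv))

      arcsBetween≡ : ∀ i j → arcsBetween i j ≡ 𝟙 (not (i == j))
      arcsBetween≡ i j with <-cmp i j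
      ... | tri≈ _ i≡j _ = trans
        (sum-zero _ λ u → sum-zero _ λ v → arc-term-zero u v λ cu cv uv → cross u v uv (trans cu (trans i≡j (sym cv))))
        (cong (λ x → 𝟙 (not x)) (sym (≡⇒== i≡j)))
      ... | tri< i<j i≢j _ with unique-edge i j i<j
      ...   | a , b , ca , cb , ab , only-ab = trans
        (sum₂-unique _ a b λ u v ¬ab → arc-term-zero u v λ cu cv uv → ¬ab (only-ab u v cu cv uv))
        (trans (arc-term-one a b ca cb ab) (cong (λ x → 𝟙 (not x)) (sym (≢⇒==-false i≢j))))
      arcsBetween≡ i j | tri> _ i≢j j<i with unique-edge j i j<i
      ...   | a , b , ca , cb , ab , only-ab = trans
        (sum₂-unique _ b a λ u v ¬ba → arc-term-zero u v λ cu cv uv →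
          ¬ba (swap (only-ab v u cv cu (trans (Graph.sym G v u) uv))))
        (trans (arc-term-one b a cb ca (trans (Graph.sym G b a) ab)) (cong (λ x → 𝟙 (not x)) (sym (≢⇒==-false i≢j))))

      fullArcs : ℕ
      fullArcs = ∑[ u < n ] ∑[ v < n ] (𝟙 (full (c u)) * 𝟙 (full (c v)) * 𝟙 (adj G u v))

      fullArcs≡ : fullArcs ≡ ∑[ i < k ] ∑[ j < k ] (𝟙 (full i) * 𝟙 (full j) * 𝟙 (not (i == j)))
      fullArcs≡ = trans (sum₂-fibres c (λ i j → 𝟙 (full i) * 𝟙 (full j)) (λ u v → 𝟙 (adj G u v)))
                        (sum-cong-≗ λ i → sum-cong-≗ λ j → cong (𝟙 (full i) * 𝟙 (full j) *_) (arcsBetween≡ i j))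

      stray : Fin n → Fin n → Bool
      stray u v = (adj G u v ∧ (s u ∧ s v)) ∧ not (full (c u) ∧ full (c v))

      strayArcs : ℕ
      strayArcs = ∑[ u < n ] count (stray u)

      arcsWithin≡fullArcs+strayArcs : arcsWithin G s ≡ fullArcs + strayArcs
      arcsWithin≡fullArcs+strayArcs = begin
        arcsWithin G s
          ≡⟨ sum-cong-≗ (λ u → trans (sum-cong-≗ (split u)) (∑-distrib-+ (good u) _)) ⟩
        ∑[ u < n ] (∑[ v < n ] good u v + count (stray u))
          ≡⟨ ∑-distrib-+ (λ u → ∑[ v < n ] good u v) _ ⟩
        fullArcs + strayArcs ∎
        where
        split-by : ∀ a p q → (q ≡ true → p ≡ true) → 𝟙 (a ∧ p) ≡ 𝟙 q * 𝟙 a + 𝟙 ((a ∧ p) ∧ not q)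
        split-by a p     false _   = cong 𝟙 (sym (∧-identityʳ (a ∧ p)))
        split-by a p     true  q⇒p rewrite q⇒p refl with a
        ... | true  = refl
        ... | false = refl
        full⇒s : ∀ u v → full (c u) ∧ full (c v) ≡ true → s u ∧ s v ≡ true
        full⇒s u v fu∧fv with Equivalence.to ∧≡true⇔ fu∧fv
        ... | fu , fv = Equivalence.from ∧≡true⇔
                          (Equivalence.to (full⇔ (c u)) fu u refl , Equivalence.to (full⇔ (c v)) fv v refl)
        good : Fin n → Fin n → ℕ
        good u v = 𝟙 (full (c u)) * 𝟙 (full (c v)) * 𝟙 (adj G u v)
        split : ∀ u v → 𝟙 (adj G u v ∧ (s u ∧ s v)) ≡ good u v + 𝟙 (stray u v)
        split u v = trans (split-by (adj G u v) (s u ∧ s v) (full (c u) ∧ full (c v)) (full⇒s u v))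
                          (cong (λ x → x * 𝟙 (adj G u v) + 𝟙 (stray u v)) (𝟙-∧ (full (c u)) (full (c v))))

      arcsWithin+fullCount : arcsWithin G s + fullCount ≡ fullCount * fullCount + strayArcs
      arcsWithin+fullCount = begin
        arcsWithin G s + fullCount       ≡⟨ cong (_+ fullCount) arcsWithin≡fullArcs+strayArcs ⟩
        fullArcs + strayArcs + fullCount   ≡⟨ solve 3 (λ x b m → x :+ b :+ m := m :+ x :+ b)
                                                    refl fullArcs strayArcs fullCount ⟩
        fullCount + fullArcs + strayArcs   ≡⟨ cong (λ x → fullCount + x + strayArcs) fullArcs≡ ⟩
        fullCount + ∑[ i < k ] ∑[ j < k ] (𝟙 (full i) * 𝟙 (full j) * 𝟙 (not (i == j))) + strayArcs
                                         ≡⟨ cong (_+ strayArcs) (count-pairs full) ⟨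
        fullCount * fullCount + strayArcs  ∎

      InsideArcsJoinFull : Set
      InsideArcsJoinFull = ∀ u v → adj G u v ≡ true → s u ≡ true → s v ≡ true → Full (c u) × Full (c v)

      strayArcs≡0⇔ : strayArcs ≡ 0 ⇔ InsideArcsJoinFull
      strayArcs≡0⇔ = mk⇔ to from
        where
        inside : ∀ {u v} → adj G u v ≡ true → s u ≡ true → s v ≡ true → adj G u v ∧ (s u ∧ s v) ≡ true
        inside uv su sv = Equivalence.from ∧≡true⇔ (uv , Equivalence.from ∧≡true⇔ (su , sv))
        to : strayArcs ≡ 0 → InsideArcsJoinFull
        to strayArcs≡0 u v uv su sv =
          Data.Product.map (λ fu → Equivalence.to (full⇔ (c u)) fu) (λ fv → Equivalence.to (full⇔ (c v)) fv)
                           (Equivalence.to ∧≡true⇔ (not-injective (trans (sym (cong (_∧ not _) (inside uv su sv))) not-stray)))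
          where
          not-stray : stray u v ≡ false
          not-stray = Equivalence.to (count≡0⇔ (stray u)) (sum≡0⇒ _ strayArcs≡0 u) v
        implied : ∀ x y → (x ≡ true → y ≡ true) → x ∧ not y ≡ false
        implied false y      _  = refl
        implied true  y x⇒y rewrite x⇒y refl = refl
        from : InsideArcsJoinFull → strayArcs ≡ 0
        from join = sum-zero _ λ u → Equivalence.from (count≡0⇔ (stray u)) λ v → implied _ _ λ uv∧su∧sv →
          let (uv , su∧sv) = Equivalence.to ∧≡true⇔ uv∧su∧sv
              (su , sv)    = Equivalence.to ∧≡true⇔ su∧sv
              (fu , fv)    = join u v uv su sv
          in Equivalence.from ∧≡true⇔ (Equivalence.from (full⇔ (c u)) fu , Equivalence.from (full⇔ (c v)) fv)

      one-full⇔ConditionI : (fullCount ≡ 1 × InsideArcsJoinFull) ⇔ ConditionI G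
      one-full⇔ConditionI = mk⇔ to from
        where
        to : fullCount ≡ 1 × InsideArcsJoinFull → ConditionI G
        to (one , join) with Equivalence.to (count≡1⇔ full) one
        ... | i , fi , only-i = i , Equivalence.to (full⇔ i) fi , only , no-arc
          where
          only : ∀ i′ → Full i′ → i′ ≡ i
          only i′ = only-i i′ ∘ Equivalence.from (full⇔ i′)
          no-arc : ∀ u v → adj G u v ≡ true → s u ≡ true → s v ≡ true → ⊥
          no-arc u v uv su sv = let (fu , fv) = join u v uv su sv in cross u v uv (trans (only _ fu) (sym (only _ fv)))
        from : ConditionI G → fullCount ≡ 1 × InsideArcsJoinFull
        from (i , fi , only , no-arc) =
          Equivalence.from (count≡1⇔ full)
            (i , Equivalence.from (full⇔ i) fi , λ i′ → only i′ ∘ Equivalence.to (full⇔ i′)) ,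
          λ u v uv su sv → ⊥-elim (no-arc u v uv su sv)

      two-full⇔ConditionII : (fullCount ≡ 2 × InsideArcsJoinFull) ⇔ ConditionII G
      two-full⇔ConditionII = mk⇔ to from
        where
        to : fullCount ≡ 2 × InsideArcsJoinFull → ConditionII G
        to (two , join) with Equivalence.to (count≡2⇔ full) two
        ... | i₁ , i₂ , i₁≢i₂ , members = i₁ , i₂ , i₁≢i₂ , Full⇔ , ends
          where
          Full⇔ : ∀ i → Full i ⇔ ((i ≡ i₁) ⊎ (i ≡ i₂))
          Full⇔ i = mk⇔ (Equivalence.to (members i) ∘ Equivalence.from (full⇔ i))
                        (Equivalence.to (full⇔ i) ∘ Equivalence.from (members i))
          ends : ∀ u v → adj G u v ≡ true → s u ≡ true → s v ≡ true →
            ((c u ≡ i₁) × (c v ≡ i₂)) ⊎ ((c u ≡ i₂) × (c v ≡ i₁))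
          ends u v uv su sv with join u v uv su sv
          ... | fu , fv with Equivalence.to (Full⇔ (c u)) fu | Equivalence.to (Full⇔ (c v)) fv
          ... | inj₁ cu | inj₂ cv = inj₁ (cu , cv)
          ... | inj₂ cu | inj₁ cv = inj₂ (cu , cv)
          ... | inj₁ cu | inj₁ cv = ⊥-elim (cross u v uv (trans cu (sym cv)))
          ... | inj₂ cu | inj₂ cv = ⊥-elim (cross u v uv (trans cu (sym cv)))
        from : ConditionII G → fullCount ≡ 2 × InsideArcsJoinFull
        from (i₁ , i₂ , i₁≢i₂ , Full⇔ , ends) =
          Equivalence.from (count≡2⇔ full)
            (i₁ , i₂ , i₁≢i₂ , λ i → mk⇔ (Equivalence.to (Full⇔ i) ∘ Equivalence.to (full⇔ i))
                                          (Equivalence.from (full⇔ i) ∘ Equivalence.from (Full⇔ i))) ,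
          join
          where
          full-end : ∀ {i} → (i ≡ i₁) ⊎ (i ≡ i₂) → Full i
          full-end = Equivalence.from (Full⇔ _)
          join : InsideArcsJoinFull
          join u v uv su sv with ends u v uv su sv
          ... | inj₁ (cu , cv) = full-end (inj₁ cu) , full-end (inj₂ cv)
          ... | inj₂ (cu , cv) = full-end (inj₂ cu) , full-end (inj₁ cv)

    module _ (H : Graph n)
      (disjoint : ∀ u v w → adj H u v ≡ true → adj H u w ≡ true → v ≡ w)
      (components : ∀ u v → (c u ≡ c v) ⇔ ((u ≡ v) ⊎ (adj H u v ≡ true)))
      (nonempty : ∀ i → ∃ λ u → c u ≡ i)
      (G : Graph n)
      (cross : ∀ u v → adj G u v ≡ true → c u ≢ c v)
      (unique-edge : ∀ i j → i < j →
        Σ (Fin n) λ a → Σ (Fin n) λ b →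
          c a ≡ i × c b ≡ j × adj G a b ≡ true ×
          (∀ a′ b′ → c a′ ≡ i → c b′ ≡ j → adj G a′ b′ ≡ true → (a′ ≡ a) × (b′ ≡ b)))
      where

      open Matching H disjoint components
      open OneEdgeBetween G cross unique-edge

      edges-quadratic : 2 * edgesWithin G s + fullCount ≡ fullCount * fullCount + strayArcs
      edges-quadratic = trans (cong (_+ fullCount) (sym (arcsWithin≡2*edgesWithin G s))) arcsWithin+fullCount

      within-bound : edgesWithin H s + isolatedWithin H s ≤ edgesWithin G s + 1
      within-bound rewrite matched+isolated≡fullCount nonempty = quadratic-bound _ _ _ edges-quadratic

      within-tight : (edgesWithin H s + isolatedWithin H s ≡ edgesWithin G s + 1) ⇔ (ConditionI G ⊎ ConditionII G)
      within-tight rewrite matched+isolated≡fullCount nonempty = mk⇔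
        (λ tight → case Equivalence.to (quadratic-tight _ _ _ edges-quadratic) tight of λ where
          (inj₁ one , B≡0) → inj₁ (Equivalence.to one-full⇔ConditionI (one , Equivalence.to strayArcs≡0⇔ B≡0))
          (inj₂ two , B≡0) → inj₂ (Equivalence.to two-full⇔ConditionII (two , Equivalence.to strayArcs≡0⇔ B≡0)))
        (λ where
          (inj₁ I)  → let (one , join) = Equivalence.from one-full⇔ConditionI I in
                      Equivalence.from (quadratic-tight _ _ _ edges-quadratic) (inj₁ one , Equivalence.from strayArcs≡0⇔ join)
          (inj₂ II) → let (two , join) = Equivalence.from two-full⇔ConditionII II in
                      Equivalence.from (quadratic-tight _ _ _ edges-quadratic) (inj₂ two , Equivalence.from strayArcs≡0⇔ join))

module RationalSums where

  open import Algebra.Bundles using (CommutativeRing)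
  open import Data.Fin using (Fin; zero; suc)
  open import Data.Nat as ℕ using (ℕ; zero; suc; z≤n; s≤s)
  import Data.Nat.Properties as ℕ
  open import Data.Rational using (ℚ; 0ℚ; 1ℚ; ½; _+_; _-_; _*_; -_; _≤_; _<_)
  open import Data.Rational.Properties
    using ( +-*-commutativeRing; +-0-monoid; ≤-refl; +-mono-≤; +-monoʳ-≤; +-monoˡ-≤; +-mono-<-≤; <-≤-trans; <⇒≢
          ; +-identityˡ; nonNegative⁻¹; positive⁻¹; *-monoˡ-≤-nonNeg; module ≤-Reasoning)
  open import Data.Rational.Solver using (module +-*-Solver)
  open import Function using (_∘_)
  open import Function.Bundles using (_⇔_; mk⇔)
  open import Relation.Binary using (tri<; tri≈; tri>)
  open import Relation.Binary.PropositionalEquality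
  open import Relation.Nullary using (contradiction)
  open import Defs using (Σℚ; two)
  open +-*-Solver using (solve; _:=_; _:+_; _:-_; _:*_; con)
  open Counting using (sum)

  open import Algebra.Properties.Semiring.Sum (CommutativeRing.semiring +-*-commutativeRing) as ℚΣ
    using (∑-distrib-+; ∑-comm; *-distribˡ-sum)
  open import Algebra.Properties.Monoid.Mult +-0-monoid using (_×_; ×-homo-+)

  Σℚ≡sum : ∀ m (f : Fin m → ℚ) → Σℚ m f ≡ ℚΣ.sum f
  Σℚ≡sum zero    f = refl
  Σℚ≡sum (suc m) f = cong (f zero +_) (Σℚ≡sum m (f ∘ suc))

  Σℚ-cong : ∀ m {f g : Fin m → ℚ} → (∀ i → f i ≡ g i) → Σℚ m f ≡ Σℚ m g
  Σℚ-cong zero    f≡g = refl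
  Σℚ-cong (suc m) f≡g = cong₂ _+_ (f≡g zero) (Σℚ-cong m (f≡g ∘ suc))

  Σℚ-distrib-+ : ∀ m (f g : Fin m → ℚ) → Σℚ m (λ i → f i + g i) ≡ Σℚ m f + Σℚ m g
  Σℚ-distrib-+ m f g =
    trans (Σℚ≡sum m _) (trans (∑-distrib-+ f g) (sym (cong₂ _+_ (Σℚ≡sum m f) (Σℚ≡sum m g))))

  *-distribˡ-Σℚ : ∀ m q (f : Fin m → ℚ) → q * Σℚ m f ≡ Σℚ m (λ i → q * f i)
  *-distribˡ-Σℚ m q f = trans (cong (q *_) (Σℚ≡sum m f)) (trans (*-distribˡ-sum q f) (sym (Σℚ≡sum m _)))

  Σℚ-comm : ∀ m n (f : Fin m → Fin n → ℚ) →
    Σℚ m (λ i → Σℚ n (f i)) ≡ Σℚ n (λ j → Σℚ m (λ i → f i j))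
  Σℚ-comm m n f = begin
    Σℚ m (λ i → Σℚ n (f i))             ≡⟨ trans (Σℚ-cong m λ i → Σℚ≡sum n (f i)) (Σℚ≡sum m _) ⟩
    ℚΣ.sum (λ i → ℚΣ.sum (f i))         ≡⟨ ∑-comm f ⟩
    ℚΣ.sum (λ j → ℚΣ.sum (λ i → f i j)) ≡⟨ trans (Σℚ-cong n λ j → Σℚ≡sum m _) (Σℚ≡sum n _) ⟨
    Σℚ n (λ j → Σℚ m (λ i → f i j))     ∎
    where open ≡-Reasoning

  Σℚ-mono-≤ : ∀ m {f g : Fin m → ℚ} → (∀ i → f i ≤ g i) → Σℚ m f ≤ Σℚ m g
  Σℚ-mono-≤ zero    f≤g = ≤-refl
  Σℚ-mono-≤ (suc m) f≤g = +-mono-≤ (f≤g zero) (Σℚ-mono-≤ m (f≤g ∘ suc))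

  toℚ : ℕ → ℚ
  toℚ n = n × 1ℚ

  toℚ-+ : ∀ a b → toℚ (a ℕ.+ b) ≡ toℚ a + toℚ b
  toℚ-+ a b = ×-homo-+ 1ℚ a b

  Σℚ-toℚ : ∀ m (f : Fin m → ℕ) → Σℚ m (toℚ ∘ f) ≡ toℚ (sum f)
  Σℚ-toℚ zero    f = refl
  Σℚ-toℚ (suc m) f = trans (cong (toℚ (f zero) +_) (Σℚ-toℚ m (f ∘ suc))) (sym (toℚ-+ (f zero) _))

  toℚ-nonNeg : ∀ a → 0ℚ ≤ toℚ a
  toℚ-nonNeg zero    = ≤-refl
  toℚ-nonNeg (suc a) = +-mono-≤ (nonNegative⁻¹ 1ℚ) (toℚ-nonNeg a)

  toℚ-mono-≤ : ∀ {a b} → a ℕ.≤ b → toℚ a ≤ toℚ b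
  toℚ-mono-≤ {b = b} z≤n = toℚ-nonNeg b
  toℚ-mono-≤ (s≤s a≤b)   = +-monoʳ-≤ 1ℚ (toℚ-mono-≤ a≤b)

  toℚ-mono-< : ∀ {a b} → a ℕ.< b → toℚ a < toℚ b
  toℚ-mono-< {a} a<b = <-≤-trans a<1+a (toℚ-mono-≤ a<b)
    where
    a<1+a : toℚ a < 1ℚ + toℚ a
    a<1+a = subst (_< 1ℚ + toℚ a) (+-identityˡ (toℚ a)) (+-mono-<-≤ (positive⁻¹ 1ℚ) (≤-refl {toℚ a}))

  toℚ-injective : ∀ {a b} → toℚ a ≡ toℚ b → a ≡ b
  toℚ-injective {a} {b} eq with ℕ.<-cmp a b
  ... | tri< a<b _ _ = contradiction eq (<⇒≢ (toℚ-mono-< a<b))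
  ... | tri≈ _ a≡b _ = a≡b
  ... | tri> _ _ b<a = contradiction (sym eq) (<⇒≢ (toℚ-mono-< b<a))

  toℚ-+1 : ∀ b → toℚ (b ℕ.+ 1) ≡ toℚ b + 1ℚ
  toℚ-+1 b = toℚ-+ b 1

  two*[toℚ-toℚ]≤two : ∀ a b → a ℕ.≤ b ℕ.+ 1 → two * (toℚ a - toℚ b) ≤ two
  two*[toℚ-toℚ]≤two a b a≤b+1 = begin
    two * (toℚ a - toℚ b)            ≤⟨ *-monoˡ-≤-nonNeg two (+-monoˡ-≤ (- toℚ b) (toℚ-mono-≤ a≤b+1)) ⟩
    two * (toℚ (b ℕ.+ 1) - toℚ b)    ≡⟨ cong (λ x → two * (x - toℚ b)) (toℚ-+1 b) ⟩
    two * ((toℚ b + 1ℚ) - toℚ b)     ≡⟨ solve 1 (λ x → con two :* ((x :+ con 1ℚ) :- x) := con two) refl (toℚ b) ⟩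
    two                              ∎
    where open ≤-Reasoning

  two*[toℚ-toℚ]≡two⇔ : ∀ a b → (two * (toℚ a - toℚ b) ≡ two) ⇔ (a ≡ b ℕ.+ 1)
  two*[toℚ-toℚ]≡two⇔ a b = mk⇔ to from
    where
    open ≡-Reasoning
    to : two * (toℚ a - toℚ b) ≡ two → a ≡ b ℕ.+ 1
    to tight = toℚ-injective (begin
      toℚ a                                 ≡⟨ solve 2 (λ x y → x := con ½ :* (con two :* (x :- y)) :+ y)
                                                       refl (toℚ a) (toℚ b) ⟩
      ½ * (two * (toℚ a - toℚ b)) + toℚ b   ≡⟨ cong (λ t → ½ * t + toℚ b) tight ⟩
      ½ * two + toℚ b                      ≡⟨ solve 1 (λ y → con ½ :* con two :+ y := y :+ con 1ℚ) refl (toℚ b) ⟩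
      toℚ b + 1ℚ                           ≡⟨ toℚ-+1 b ⟨
      toℚ (b ℕ.+ 1)                        ∎)
    from : a ≡ b ℕ.+ 1 → two * (toℚ a - toℚ b) ≡ two
    from refl = begin
      two * (toℚ (b ℕ.+ 1) - toℚ b)    ≡⟨ cong (λ x → two * (x - toℚ b)) (toℚ-+1 b) ⟩
      two * ((toℚ b + 1ℚ) - toℚ b)     ≡⟨ solve 1 (λ x → con two :* ((x :+ con 1ℚ) :- x) := con two) refl (toℚ b) ⟩
      two                              ∎

module Convexity where

  open import Data.Bool using (true; false; if_then_else_; _∧_)
  open import Data.Fin using (Fin)
  open import Data.Fin.Properties using (<-cmp; _<?_)
  open import Data.Nat using (suc)
  open import Data.Product using (_,_)
  open import Data.Rational using (ℚ; 0ℚ; 1ℚ; _+_; _-_; _*_; -_; _≤_; nonNegative)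
  open import Data.Rational.Properties
    using ( +-*-commutativeRing; *-comm; *-zeroˡ; *-identityˡ; *-identityʳ; *-distribˡ-+; neg-distribˡ-*
          ; *-monoˡ-≤-nonNeg; module ≤-Reasoning)
  open import Algebra.Bundles using (CommutativeRing)
  open import Algebra.Properties.CommutativeSemigroup (CommutativeRing.*-commutativeSemigroup +-*-commutativeRing)
    using (x∙yz≈y∙xz)
  open import Relation.Binary using (tri<; tri≈; tri>)
  open import Relation.Binary.PropositionalEquality
  open import Relation.Nullary.Decidable using (⌊_⌋)
  open import Defs hiding (sym)
  open RationalSums

  module Commutation {N m} (λs : Fin m → ℚ) (ys : Fin m → Edge N → ℚ) (x : Edge N → ℚ)
           (x≡ : ∀ e → x e ≡ Σℚ m (λ j → λs j * ys j e)) where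

    Commutes : ((Edge N → ℚ) → ℚ) → Set
    Commutes Φ = Φ x ≡ Σℚ m (λ j → λs j * Φ (ys j))

    zero-commutes : Commutes (λ _ → 0ℚ)
    zero-commutes = sym (trans (Σℚ-cong m (λ j → *-comm (λs j) 0ℚ))
                               (trans (sym (*-distribˡ-Σℚ m 0ℚ λs)) (*-zeroˡ (Σℚ m λs))))

    coord-commutes : ∀ a b → Commutes (λ y → coord y a b)
    coord-commutes a b with <-cmp a b
    ... | tri< a<b _ _ = x≡ (a , b , a<b)
    ... | tri≈ _ _ _   = zero-commutes
    ... | tri> _ _ b<a = x≡ (b , a , b<a)

    +-commutes : ∀ {Φ Ψ} → Commutes Φ → Commutes Ψ → Commutes (λ y → Φ y + Ψ y)
    +-commutes {Φ} {Ψ} Φ-commutes Ψ-commutes =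
      trans (cong₂ _+_ Φ-commutes Ψ-commutes)
            (trans (sym (Σℚ-distrib-+ m _ _)) (Σℚ-cong m (λ j → sym (*-distribˡ-+ (λs j) (Φ (ys j)) (Ψ (ys j))))))

    *-commutes : ∀ {Φ} q → Commutes Φ → Commutes (λ y → q * Φ y)
    *-commutes {Φ} q Φ-commutes =
      trans (cong (q *_) Φ-commutes)
            (trans (*-distribˡ-Σℚ m q _) (Σℚ-cong m (λ j → x∙yz≈y∙xz q (λs j) (Φ (ys j)))))

    neg-commutes : ∀ {Φ} → Commutes Φ → Commutes (λ y → - Φ y)
    neg-commutes {Φ} Φ-commutes =
      trans (-‿as-* (Φ x))
            (trans (*-commutes (- 1ℚ) Φ-commutes) (Σℚ-cong m λ j → cong (λs j *_) (sym (-‿as-* (Φ (ys j))))))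
      where
      -‿as-* : ∀ p → - p ≡ - 1ℚ * p
      -‿as-* p = trans (cong -_ (sym (*-identityˡ p))) (neg-distribˡ-* 1ℚ p)

    -‿commutes : ∀ {Φ Ψ} → Commutes Φ → Commutes Ψ → Commutes (λ y → Φ y - Ψ y)
    -‿commutes Φ-commutes Ψ-commutes = +-commutes Φ-commutes (neg-commutes Ψ-commutes)

    Σℚ-commutes : ∀ {n} {Φ : Fin n → (Edge N → ℚ) → ℚ} → (∀ u → Commutes (Φ u)) →
      Commutes (λ y → Σℚ n (λ u → Φ u y))
    Σℚ-commutes {n} {Φ} Φ-commutes =
      trans (Σℚ-cong n Φ-commutes)
            (trans (Σℚ-comm n m _) (Σℚ-cong m (λ j → sym (*-distribˡ-Σℚ n (λs j) (λ u → Φ u (ys j))))))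

    if-commutes : ∀ {Φ} b → Commutes Φ → Commutes (λ y → if b then Φ y else 0ℚ)
    if-commutes true  Φ-commutes = Φ-commutes
    if-commutes false _          = zero-commutes

    T-commutes : ∀ a b c → Commutes (λ y → T y a b c)
    T-commutes a b c = -‿commutes (-‿commutes (coord-commutes a b) (coord-commutes a c)) (coord-commutes b c)

    ΣEdges-commutes : ∀ {n} (K : Graph n) {f : Fin n → Fin n → (Edge N → ℚ) → ℚ} →
      (∀ u v → Commutes (f u v)) → Commutes (λ y → ΣEdges K (λ u v → f u v y))
    ΣEdges-commutes K f-commutes =
      Σℚ-commutes λ u → Σℚ-commutes λ v → if-commutes (adj K u v ∧ ⌊ u <? v ⌋) (f-commutes u v)

  open Commutation using (Commutes)

  lhsI-commutes : ∀ n (G H : Graph n) {m} λs ys x x≡ → Commutes {suc n} {m} λs ys x x≡ (lhsI n G H)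
  lhsI-commutes n G H λs ys x x≡ =
    +-commutes (-‿commutes (ΣEdges-commutes G T-apex) (ΣEdges-commutes H T-apex))
               (*-commutes two (Σℚ-commutes λ u → if-commutes (isolated H u) (coord-commutes (node u) (apex n))))
    where
    open Commutation λs ys x x≡ hiding (Commutes)
    T-apex : ∀ u v → Commutes λs ys x x≡ (λ y → T y (node u) (node v) (apex n))
    T-apex u v = T-commutes (node u) (node v) (apex n)

  valid-from-cuts : ∀ {N} (Φ : (Edge N → ℚ) → ℚ) b →
    (∀ {m} λs ys x x≡ → Commutes {N} {m} λs ys x x≡ Φ) → (∀ S → Φ (δ S) ≤ b) → ValidForCUT N Φ b
  valid-from-cuts Φ b Φ-commutes cut≤b x (m , λs , Ss , λ≥0 , Σλ≡1 , x≡) = begin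
    Φ x                                  ≡⟨ Φ-commutes λs (λ j → δ (Ss j)) x x≡ ⟩
    Σℚ m (λ j → λs j * Φ (δ (Ss j)))
      ≤⟨ Σℚ-mono-≤ m (λ j → *-monoˡ-≤-nonNeg (λs j) {{nonNegative (λ≥0 j)}} (cut≤b (Ss j))) ⟩
    Σℚ m (λ j → λs j * b)                ≡⟨ Σℚ-cong m (λ j → *-comm b (λs j)) ⟨
    Σℚ m (λ j → b * λs j)                ≡⟨ *-distribˡ-Σℚ m b λs ⟨
    b * Σℚ m λs                          ≡⟨ cong (b *_) Σλ≡1 ⟩
    b * 1ℚ                               ≡⟨ *-identityʳ b ⟩
    b                                    ∎
    where open ≤-Reasoning

module CutValues where

  open import Data.Bool using (Bool; true; false; if_then_else_; _∧_; _xor_)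
  open import Data.Bool.Properties using (xor-comm)
  open import Data.Fin using (Fin; zero; suc)
  open import Data.Fin.Properties using (<-cmp; _<?_; fromℕ≢inject₁; inject₁-injective)
  open import Data.Nat using (ℕ; zero; suc)
  import Data.Nat as ℕ
  open import Data.Rational using (ℚ; 0ℚ; 1ℚ; _+_; _-_; _*_; -_)
  open import Data.Rational.Properties using (*-zeroʳ)
  open import Data.Rational.Solver using (module +-*-Solver)
  open import Data.Product using (proj₁)
  open import Function using (_∘_)
  open import Function.Bundles using (Equivalence)
  open import Relation.Binary using (tri<; tri≈; tri>)
  open import Relation.Binary.PropositionalEquality
  open import Relation.Nullary using (contradiction)
  open import Relation.Nullary.Decidable using (⌊_⌋)
  open import Defs hiding (sym)
  open Counting using (𝟙; count; ∧≡true⇔)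
  open EdgeCounts using (edgesWithin; isolatedWithin)
  open RationalSums
  open +-*-Solver using (solve; _:=_; _:+_; _:-_; _:*_; :-_; con)
  open ≡-Reasoning

  indicator : ∀ b → (if b then 1ℚ else 0ℚ) ≡ toℚ (𝟙 b)
  indicator true  = refl
  indicator false = refl

  Σℚ₂-scaled-indicator : ∀ {n} q (b : Fin n → Fin n → Bool) →
    Σℚ n (λ u → Σℚ n (λ v → q * toℚ (𝟙 (b u v)))) ≡ q * toℚ (Counting.sum (λ u → count (b u)))
  Σℚ₂-scaled-indicator {n} q b = begin
    Σℚ n (λ u → Σℚ n (λ v → q * toℚ (𝟙 (b u v))))  ≡⟨ Σℚ-cong n (λ u → *-distribˡ-Σℚ n q _) ⟨
    Σℚ n (λ u → q * Σℚ n (λ v → toℚ (𝟙 (b u v))))  ≡⟨ *-distribˡ-Σℚ n q _ ⟨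
    q * Σℚ n (λ u → Σℚ n (λ v → toℚ (𝟙 (b u v))))  ≡⟨ cong (q *_) (Σℚ-cong n λ u → Σℚ-toℚ n (𝟙 ∘ b u)) ⟩
    q * Σℚ n (λ u → toℚ (count (b u)))               ≡⟨ cong (q *_) (Σℚ-toℚ n _) ⟩
    q * toℚ (Counting.sum (λ u → count (b u)))       ∎

  extend-node : ∀ {n} (S : Fin n → Bool) u → extend S (node u) ≡ S u
  extend-node {suc n} S zero    = refl
  extend-node {suc n} S (suc u) = extend-node (λ j → S (suc j)) u

  extend-apex : ∀ n (S : Fin n → Bool) → extend S (apex n) ≡ false
  extend-apex zero    S = refl
  extend-apex (suc n) S = extend-apex n (λ j → S (suc j))

  -- δ(S) = δ(complement of S), so only the shore s of V not on the side of the apex matters.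
  module _ {n} (S : Fin (suc n) → Bool) (s : Fin n → Bool) (s≡ : ∀ u → S (node u) xor S (apex n) ≡ s u) where

    coord-δ : ∀ {a b} → a ≢ b → coord (δ S) a b ≡ toℚ (𝟙 (S a xor S b))
    coord-δ {a} {b} a≢b with <-cmp a b
    ... | tri< _ _ _   = indicator (S a xor S b)
    ... | tri≈ _ a≡b _ = contradiction a≡b a≢b
    ... | tri> _ _ _   = trans (indicator (S b xor S a)) (cong (λ x → toℚ (𝟙 x)) (xor-comm (S b) (S a)))

    node≢apex : ∀ u → node u ≢ apex n
    node≢apex u = fromℕ≢inject₁ ∘ sym

    T-δ : ∀ {u v} → u ≢ v → T (δ S) (node u) (node v) (apex n) ≡ - two * toℚ (𝟙 (s u ∧ s v))
    T-δ {u} {v} u≢v = begin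
      T (δ S) (node u) (node v) (apex n)
        ≡⟨ cong₂ _-_ (cong₂ _-_ (coord-δ (u≢v ∘ inject₁-injective)) (coord-δ (node≢apex u)))
                     (coord-δ (node≢apex v)) ⟩
      toℚ (𝟙 (Su xor Sv)) - toℚ (𝟙 (Su xor Sa)) - toℚ (𝟙 (Sv xor Sa))
        ≡⟨ cong (λ x → toℚ (𝟙 x) - toℚ (𝟙 (Su xor Sa)) - toℚ (𝟙 (Sv xor Sa))) (relative-to Su Sv Sa) ⟩
      toℚ (𝟙 ((Su xor Sa) xor (Sv xor Sa))) - toℚ (𝟙 (Su xor Sa)) - toℚ (𝟙 (Sv xor Sa))
        ≡⟨ cong₂ (λ x y → toℚ (𝟙 (x xor y)) - toℚ (𝟙 x) - toℚ (𝟙 y)) (s≡ u) (s≡ v) ⟩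
      toℚ (𝟙 (s u xor s v)) - toℚ (𝟙 (s u)) - toℚ (𝟙 (s v))
        ≡⟨ triangle (s u) (s v) ⟩
      - two * toℚ (𝟙 (s u ∧ s v)) ∎
      where
      Su Sv Sa : Bool
      Su = S (node u)
      Sv = S (node v)
      Sa = S (apex n)
      relative-to : ∀ a b c → a xor b ≡ (a xor c) xor (b xor c)
      relative-to true  true  true  = refl
      relative-to true  true  false = refl
      relative-to true  false true  = refl
      relative-to true  false false = refl
      relative-to false true  true  = refl
      relative-to false true  false = refl
      relative-to false false true  = refl
      relative-to false false false = refl
      triangle : ∀ x y → toℚ (𝟙 (x xor y)) - toℚ (𝟙 x) - toℚ (𝟙 y) ≡ - two * toℚ (𝟙 (x ∧ y))
      triangle true  true  = refl
      triangle true  false = refl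
      triangle false true  = refl
      triangle false false = refl

    ΣEdges-δ : ∀ (K : Graph n) →
      ΣEdges K (λ u v → T (δ S) (node u) (node v) (apex n)) ≡ - two * toℚ (edgesWithin K s)
    ΣEdges-δ K = trans (Σℚ-cong n λ u → Σℚ-cong n λ v → term u v) (Σℚ₂-scaled-indicator (- two) inside)
      where
      inside : Fin n → Fin n → Bool
      inside u v = (adj K u v ∧ ⌊ u <? v ⌋) ∧ (s u ∧ s v)
      edge⇒≢ : ∀ {u v} → adj K u v ∧ ⌊ u <? v ⌋ ≡ true → u ≢ v
      edge⇒≢ {u} edge refl = contradiction (trans (sym (proj₁ (Equivalence.to ∧≡true⇔ edge))) (Graph.irrefl K u)) λ ()
      term : ∀ u v → (if adj K u v ∧ ⌊ u <? v ⌋ then T (δ S) (node u) (node v) (apex n) else 0ℚ)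
                   ≡ - two * toℚ (𝟙 (inside u v))
      term u v with adj K u v ∧ ⌊ u <? v ⌋ in edge
      ... | true  = T-δ (edge⇒≢ edge)
      ... | false = sym (*-zeroʳ (- two))

    isolated-δ : ∀ (H : Graph n) →
      Σℚ n (λ u → if isolated H u then coord (δ S) (node u) (apex n) else 0ℚ) ≡ toℚ (isolatedWithin H s)
    isolated-δ H = trans (Σℚ-cong n term) (Σℚ-toℚ n _)
      where
      term : ∀ u → (if isolated H u then coord (δ S) (node u) (apex n) else 0ℚ) ≡ toℚ (𝟙 (isolated H u ∧ s u))
      term u with isolated H u
      ... | true  = trans (coord-δ (node≢apex u)) (cong (λ x → toℚ (𝟙 x)) (s≡ u))
      ... | false = refl

    lhsI-δ : ∀ (G H : Graph n) →
      lhsI n G H (δ S) ≡ two * (toℚ (edgesWithin H s ℕ.+ isolatedWithin H s) - toℚ (edgesWithin G s))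
    lhsI-δ G H = begin
      lhsI n G H (δ S)
        ≡⟨ cong₂ _+_ (cong₂ _-_ (ΣEdges-δ G) (ΣEdges-δ H)) (cong (two *_) (isolated-δ H)) ⟩
      - two * g - - two * h + two * r
        ≡⟨ solve 3 (λ g h r → (:- con two) :* g :- (:- con two) :* h :+ con two :* r := con two :* ((h :+ r) :- g))
                   refl g h r ⟩
      two * ((h + r) - g)
        ≡⟨ cong (λ x → two * (x - g)) (toℚ-+ (edgesWithin H s) (isolatedWithin H s)) ⟨
      two * (toℚ (edgesWithin H s ℕ.+ isolatedWithin H s) - g) ∎
      where
      g h r : ℚ
      g = toℚ (edgesWithin G s)
      h = toℚ (edgesWithin H s)
      r = toℚ (isolatedWithin H s)

module CutInequality where

  open import Data.Bool using (Bool; true; _xor_)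
  open import Data.Bool.Properties using (xor-identityʳ)
  open import Data.Fin using (Fin; _<_)
  open import Data.Product using (Σ; _×_)
  open import Data.Rational using (_≤_; _-_; _*_)
  open import Data.Rational.Properties using (≤-trans; ≤-reflexive)
  open import Data.Sum using (_⊎_)
  open import Function.Bundles using (_⇔_; mk⇔)
  open import Function.Properties.Equivalence using () renaming (trans to ⇔-trans)
  open import Relation.Binary.PropositionalEquality
  open import Defs hiding (sym)
  import Data.Nat as ℕ
  open EdgeCounts using (module Components; edgesWithin; isolatedWithin)
  open RationalSums using (toℚ; two*[toℚ-toℚ]≤two; two*[toℚ-toℚ]≡two⇔)
  open CutValues using (lhsI-δ; extend-node; extend-apex)

  module Cuts {n k} (G H : Graph n)
    (disjoint : ∀ u v w → adj H u v ≡ true → adj H u w ≡ true → v ≡ w)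
    (c : Fin n → Fin k)
    (nonempty : ∀ i → Σ (Fin n) λ u → c u ≡ i)
    (components : ∀ u v → (c u ≡ c v) ⇔ ((u ≡ v) ⊎ (adj H u v ≡ true)))
    (cross : ∀ u v → adj G u v ≡ true → c u ≢ c v)
    (unique-edge : ∀ i j → i < j →
      Σ (Fin n) λ a → Σ (Fin n) λ b →
        c a ≡ i × c b ≡ j × adj G a b ≡ true ×
        (∀ a′ b′ → c a′ ≡ i → c b′ ≡ j → adj G a′ b′ ≡ true → (a′ ≡ a) × (b′ ≡ b)))
    where

    cut-bound : ∀ S → lhsI n G H (δ S) ≤ two
    cut-bound S = ≤-trans (≤-reflexive (lhsI-δ S s (λ _ → refl) G H))
      (two*[toℚ-toℚ]≤two _ _ (Components.within-bound c s H disjoint components nonempty G cross unique-edge))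
      where
      s : Fin n → Bool
      s u = S (node u) xor S (apex n)

    cut-tight : ∀ S → (lhsI n G H (δ (extend S)) ≡ two) ⇔ (Components.ConditionI c S G ⊎ Components.ConditionII c S G)
    cut-tight S =
      ⇔-trans (mk⇔ (trans (sym value)) (trans value))
        (⇔-trans (two*[toℚ-toℚ]≡two⇔ _ _) (Components.within-tight c S H disjoint components nonempty G cross unique-edge))
      where
      value : lhsI n G H (δ (extend S)) ≡ two * (toℚ (edgesWithin H S ℕ.+ isolatedWithin H S) - toℚ (edgesWithin G S))
      value = lhsI-δ (extend S) S (λ u → trans (cong₂ _xor_ (extend-node S u) (extend-apex n S)) (xor-identityʳ (S u))) G H

open import Defs
open import Data.Bool using (Bool; true)
open import Data.Nat using (ℕ; suc; _≤_)
open import Data.Fin using (Fin; _<_)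
open import Data.Product using (Σ; _×_; _,_)
open import Data.Sum using (_⊎_)
open import Data.Empty using (⊥)
open import Relation.Binary.PropositionalEquality using (_≡_; _≢_)
open import Function.Bundles using (_⇔_)
open Convexity using (valid-from-cuts; lhsI-commutes)

proposition1 :
  (n : ℕ) → 1 ≤ n → (G H : Graph n) →
  -- the edges of H are pairwise node-disjoint
  (∀ u v w → adj H u v ≡ true → adj H u w ≡ true → v ≡ w) →
  -- decomposition V = V_1 ∪ … ∪ V_k into the components of H: V_i = c⁻¹(i)
  (k : ℕ) → (c : Fin n → Fin k) →
  (∀ i → Σ (Fin n) λ u → c u ≡ i) →
  (∀ u v → (c u ≡ c v) ⇔ ((u ≡ v) ⊎ (adj H u v ≡ true))) →
  -- every edge of G joins two different components
  (∀ u v → adj G u v ≡ true → c u ≢ c v) →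
  -- for i < j exactly one edge e_ij of G joins V_i and V_j
  (∀ i j → i < j →
    Σ (Fin n) λ a → Σ (Fin n) λ b →
      c a ≡ i × c b ≡ j × adj G a b ≡ true ×
      (∀ a' b' → c a' ≡ i → c b' ≡ j → adj G a' b' ≡ true → (a' ≡ a) × (b' ≡ b))) →
  -- I(G,H) is valid for CUT□_{n+1}
  ValidForCUT (suc n) (lhsI n G H) two
  ×
  -- tightness characterisation for cut vectors δ(S), S ⊆ V
  (∀ (S : Fin n → Bool) →
    (lhsI n G H (δ (extend S)) ≡ two)
    ⇔
    ( -- (i)
      (Σ (Fin k) λ i →
         (∀ u → c u ≡ i → S u ≡ true) ×
         (∀ i' → (∀ u → c u ≡ i' → S u ≡ true) → i' ≡ i) ×
         (∀ u v → adj G u v ≡ true → S u ≡ true → S v ≡ true → ⊥))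
    ⊎ -- (ii)
      (Σ (Fin k) λ i₁ → Σ (Fin k) λ i₂ →
         i₁ ≢ i₂ ×
         (∀ i → (∀ u → c u ≡ i → S u ≡ true) ⇔ ((i ≡ i₁) ⊎ (i ≡ i₂))) ×
         (∀ u v → adj G u v ≡ true → S u ≡ true → S v ≡ true →
            ((c u ≡ i₁) × (c v ≡ i₂)) ⊎ ((c u ≡ i₂) × (c v ≡ i₁))))))
proposition1 n _ G H disjoint k c nonempty components cross unique-edge =
  valid-from-cuts (lhsI n G H) two (lhsI-commutes n G H) cut-bound , cut-tight
  where open CutInequality.Cuts G H disjoint c nonempty components cross unique-edge
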